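{- Let $\mathcal{M}_1,\mathcal{M}_2$ and the relation $Z$ be as defined below. Then $Z$ is a CD-asimulation between $\mathcal{M}_1$ and $\mathcal{M}_2$.
   Context: G-models and forcing: a G-model $\langle W,\leq,\mathbf{u},D,\phi\rangle$ has a non-empty set $W$, a reflexive transitive $\leq$, a base point $\mathbf{u}\leq u$ for all $u$, a non-empty domain $D$, and monotone interpretations $\phi(P)\subseteq W\times D^k$ of $k$-ary predicates; atomic forcing $u\Vdash P\vec a$ iff $\langle u,\vec a\rangle\in\phi(P)$. The models: let $\mathbb{N}=\{0,1,2,\dots\}$, $k\mathbb{N}+l=\{kn+l\mid n\in\mathbb{N}\}$. A quasi-partition is a triple $(A,B,C)$ of pairwise disjoint subsets of $\mathbb{N}$ with union $\mathbb{N}$, $A,C$ infinite, $B$ empty or infinite; $(A,B,C)\sqsubseteq(D,E,F)$ iff $A\subseteq D$ and $F\subseteq C$. Let $\mathbf{v}=(\mathbf{v}_1,\mathbf{v}_2,\mathbf{v}_3)=(3\mathbb{N},3\mathbb{N}+1,3\mathbb{N}+2)$, $\mathbf{w}=(2\mathbb{N},\emptyset,2\mathbb{N}+1)$. $\mathcal{M}_1$: base point $\mathbf{v}$, states $W_1$ = quasi-partitions $(A,B,C)$ with $\mathbf{v}\sqsubseteq(A,B,C)$ and $B\cap\mathbf{v}_2$ infinite. $\mathcal{M}_2$: base point $\mathbf{w}$, states $W_2$ = quasi-partitions $(A,B,C)$ with $\mathbf{w}\sqsubseteq(A,B,C)$ and $B\neq\emptyset$, together with $\mathbf{w}$. Both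 ordered by $\sqsubseteq$, $D_1=D_2=\mathbb{N}$, and the only predicates are unary $P,Q$ with $(u_1,u_2,u_3)\Vdash Pa$ iff $a\in u_1\cup u_2$ and $(u_1,u_2,u_3)\Vdash Qa$ iff $a\in u_1$. The relation $Z$: for $\{i,j\}=\{1,2\}$, $(A,B,C)\in W_i$, $\vec d\in D_i^k$, $(D,E,F)\in W_j$, $\vec e\in D_j^k$ ($k\geq0$), $\langle(A,B,C),\vec d\rangle Z\langle(D,E,F),\vec e\rangle$ iff (a) the relation $\{\langle d_l,e_l\rangle\mid 1\leq l\leq k\}$ is a bijection (between the sets of entries of $\vec d$ and $\vec e$); (b) for $1\leq l\leq k$, $d_l\in A$ implies $e_l\in D$; (c) for $1\leq l\leq k$, $d_l\in B$ implies $e_l\in D\cup E$. No other pairs are in $Z$. A CD-asimulation between $\mathcal{M}_1$ and $\mathcal{M}_2$ is a relation $Z\subseteq\bigcup_{k\geq0}[(W_1\times D_1^k)\times(W_2\times D_2^k)]\cup[(W_2\times D_2^k)\times(W_1\times D_1^k)]$ such that for all $\{i,j\}=\{1,2\}$: (1) if $(v,\vec d)Z(w,\vec e)$, $v\in W_i$, and $v\Vdash_i P[\vec d]$ for an atomic formula $P[\vec x]$, then $w\Vdash_j P[\vec e]$; (2) if $(t,\vec d)Z(u,\vec e)$, $t\in W_i$, $u\leq_j v$, then there is $w\in W_i$ with $t\leq_i w$, $(w,\vec d)Z(v,\vec e)$ and $(v,\vec e)Z(w,\vec d)$; (3) if $t\in W_i$, $(t,\vec d)Z(u,\vec e)$ and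 $f\in D_i$, then there is $g\in D_j$ with $(t,\vec d f)Z(u,\vec e g)$; (4) if $t\in W_i$, $(t,\vec d)Z(u,\vec e)$ and $g\in D_j$, then there is $f\in D_i$ with $(t,\vec d f)Z(u,\vec e g)$. -}

module Defs where

open import Data.Nat using (ℕ; _≤_; _%_; _≡ᵇ_)
open import Data.Bool using (Bool; true; false)
open import Data.Fin using (Fin)
open import Data.Vec using (Vec; lookup; _∷ʳ_)
open import Data.Product using (Σ; ∃; _×_; _,_; proj₁; proj₂)
open import Data.Sum using (_⊎_)
open import Relation.Nullary using (¬_)
open import Relation.Binary.PropositionalEquality using (_≡_)

data PredSym : Set where
  P Q : PredSym

-- G-models (structure part; the base point and the model axioms are not
-- needed to state the asimulation conditions, so they are omitted).

record GModel : Set₁ where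
  field
    W     : Set
    _≼_   : W → W → Set
    D     : Set
    force : W → PredSym → D → Set

open GModel

-- CD-asimulation.  A relation Z between pairs (state, k-tuple) is given
-- by its two directional parts Zmn (from M to N) and Znm (from N to M).

ZRel : GModel → GModel → Set₁
ZRel M N = ∀ {k} → W M → Vec (D M) k → W N → Vec (D N) k → Set

-- conditions (1)-(4) for the direction i = M, j = N
record AsimHalf (M N : GModel) (Zmn : ZRel M N) (Znm : ZRel N M) : Set where
  field
    atom  : ∀ {k} {t : W M} {ds : Vec (D M) k} {u : W N} {es : Vec (D N) k} →
            Zmn t ds u es → (p : PredSym) (l : Fin k) →
            force M t p (lookup ds l) → force N u p (lookup es l)
    back  : ∀ {k} {t : W M} {ds : Vec (D M) k} {u : W N} {es : Vec (D N) k} →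
            Zmn t ds u es → (v : W N) → _≼_ N u v →
            Σ (W M) λ w → _≼_ M t w × Zmn w ds v es × Znm v es w ds
    forth : ∀ {k} {t : W M} {ds : Vec (D M) k} {u : W N} {es : Vec (D N) k} →
            Zmn t ds u es → (f : D M) →
            Σ (D N) λ g → Zmn t (ds ∷ʳ f) u (es ∷ʳ g)
    forth' : ∀ {k} {t : W M} {ds : Vec (D M) k} {u : W N} {es : Vec (D N) k} →
            Zmn t ds u es → (g : D N) →
            Σ (D M) λ f → Zmn t (ds ∷ʳ f) u (es ∷ʳ g)

IsCDAsimulation : (M N : GModel) → ZRel M N → ZRel N M → Set
IsCDAsimulation M N Z₁₂ Z₂₁ = AsimHalf M N Z₁₂ Z₂₁ × AsimHalf N M Z₂₁ Z₁₂

Subset : Set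
Subset = ℕ → Bool

_∈_ : ℕ → Subset → Set
n ∈ A = A n ≡ true

_⊆_ : Subset → Subset → Set
A ⊆ B = ∀ n → n ∈ A → n ∈ B

Infinite : Subset → Set
Infinite A = ∀ n → ∃ λ m → n ≤ m × m ∈ A

Empty : Subset → Set
Empty A = ∀ n → ¬ (n ∈ A)

NonEmpty : Subset → Set
NonEmpty A = ∃ λ n → n ∈ A

_∩_ : Subset → Subset → Subset
(A ∩ B) n with A n
... | true  = B n
... | false = false

record Triple : Set where
  constructor ⟨_,_,_⟩
  field
    p₁ p₂ p₃ : Subset
open Triple public

record IsQuasiPartition (u : Triple) : Set where
  field
    disj₁₂ : ∀ n → n ∈ p₁ u → ¬ (n ∈ p₂ u)
    disj₁₃ : ∀ n → n ∈ p₁ u → ¬ (n ∈ p₃ u)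
    disj₂₃ : ∀ n → n ∈ p₂ u → ¬ (n ∈ p₃ u)
    cover  : ∀ n → n ∈ p₁ u ⊎ (n ∈ p₂ u ⊎ n ∈ p₃ u)
    inf₁   : Infinite (p₁ u)
    inf₃   : Infinite (p₃ u)
    mid    : Empty (p₂ u) ⊎ Infinite (p₂ u)

_⊑_ : Triple → Triple → Set
u ⊑ u' = (p₁ u ⊆ p₁ u') × (p₃ u' ⊆ p₃ u)

𝐯 : Triple
𝐯 = ⟨ (λ n → (n % 3) ≡ᵇ 0) , (λ n → (n % 3) ≡ᵇ 1) , (λ n → (n % 3) ≡ᵇ 2) ⟩

𝐰 : Triple
𝐰 = ⟨ (λ n → (n % 2) ≡ᵇ 0) , (λ _ → false) , (λ n → (n % 2) ≡ᵇ 1) ⟩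

W₁ : Set
W₁ = Σ Triple λ u → IsQuasiPartition u × 𝐯 ⊑ u × Infinite (p₂ u ∩ p₂ 𝐯)

tri₁ : W₁ → Triple
tri₁ = proj₁

data W₂ : Set where
  base₂ : W₂
  st₂   : (u : Triple) → IsQuasiPartition u → 𝐰 ⊑ u → NonEmpty (p₂ u) → W₂

tri₂ : W₂ → Triple
tri₂ base₂           = 𝐰
tri₂ (st₂ u _ _ _) = u

forceT : Triple → PredSym → ℕ → Set
forceT u P a = a ∈ p₁ u ⊎ a ∈ p₂ u
forceT u Q a = a ∈ p₁ u

M₁ : GModel
M₁ = record
  { W     = W₁
  ; _≼_   = λ s t → tri₁ s ⊑ tri₁ t
  ; D     = ℕ
  ; force = λ s → forceT (tri₁ s)
  }

M₂ : GModel
M₂ = record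
  { W     = W₂
  ; _≼_   = λ s t → tri₂ s ⊑ tri₂ t
  ; D     = ℕ
  ; force = λ s → forceT (tri₂ s)
  }

ZT : ∀ {k} → Triple → Vec ℕ k → Triple → Vec ℕ k → Set
ZT {k} u ds u' es =
  -- (a) {⟨d_l , e_l⟩} is a bijection between the entries of ds and es
  (∀ (l l' : Fin k) → (lookup ds l ≡ lookup ds l' → lookup es l ≡ lookup es l')
                    × (lookup es l ≡ lookup es l' → lookup ds l ≡ lookup ds l'))
  × (∀ (l : Fin k) → lookup ds l ∈ p₁ u → lookup es l ∈ p₁ u')
  × (∀ (l : Fin k) → lookup ds l ∈ p₂ u → lookup es l ∈ p₁ u' ⊎ lookup es l ∈ p₂ u')

Z₁₂ : ∀ {k} → W₁ → Vec ℕ k → W₂ → Vec ℕ k → Set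
Z₁₂ s ds t es = ZT (tri₁ s) ds (tri₂ t) es

Z₂₁ : ∀ {k} → W₂ → Vec ℕ k → W₁ → Vec ℕ k → Set
Z₂₁ t es s ds = ZT (tri₂ t) es (tri₁ s) ds

module Submission where

-- Every state of M₁ and M₂ is (labelled by) a quasi-partition of ℕ and Z
-- only compares the block memberships of corresponding entries of two
-- tuples, so the argument is about triples of subsets of ℕ.
--  * (1) P and Q only look at the first two blocks, which Z transports.
--  * (3),(4) A new element already in the tuple is matched by its partner;
--    otherwise a fresh partner is taken in the infinite first block of the
--    target, resp. a fresh element in the infinite third block of the
--    source, where conditions (b),(c) are vacuous.
--  * (2) Given Z (t,ds) (u,es) and u ⊑ v, the new state is t with the
--    membership of every entry of ds overwritten by that of its partner
--    in v ("copy").  This is again a quasi-partition, extends t and is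
--    Z-related to v in both directions.  It needs an infinite middle block
--    in t; the base point 𝐰 of M₂ has an empty one, so it is first
--    enlarged to 𝐰', which moves the odd numbers ≡ 1 (mod 4) to the middle.

open import Defs
open import Data.Nat using (ℕ; zero; suc; _+_; _≤_; _<_; _⊔_; _%_; _≡ᵇ_; _≟_; z≤n; s≤s; NonZero)
open import Data.Nat.Properties using (≤-trans; <-≤-trans; <⇒≱; m≤m⊔n; m≤n⊔m; +-monoˡ-≤)
open import Data.Nat.DivMod using (%-remove-+ˡ; m%n<n)
open import Data.Nat.Divisibility using (_∣_; divides; ∣-refl)
open import Data.Bool using (Bool; true; false; _∧_; not)
open import Data.Fin using (Fin; zero; suc)
open import Data.Vec using (Vec; []; _∷_; lookup; _∷ʳ_)
open import Data.Vec.Relation.Unary.Any using (here; there; index)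
open import Data.Vec.Relation.Unary.Any.Properties using (lookup-index)
open import Data.Vec.Membership.Propositional.Properties using (∈-lookup)
open import Data.Vec.Membership.DecPropositional _≟_ using (_∈?_) renaming (_∈_ to _∈ᵥ_; _∉_ to _∉ᵥ_)
open import Data.Product using (Σ; ∃; _×_; _,_; proj₁; proj₂; swap)
open import Data.Sum using (_⊎_; inj₁; inj₂; [_,_]′)
open import Data.Empty using (⊥-elim)
open import Relation.Nullary using (¬_; yes; no)
open import Relation.Binary.PropositionalEquality using (_≡_; refl; sym; trans; cong; cong₂; subst)

open IsQuasiPartition

infinite-cofinite : ∀ {X Y : Subset} (b : ℕ) → (∀ n → b ≤ n → Y n ≡ X n) →
                    Infinite X → Infinite Y
infinite-cofinite b agree infX n with infX (n ⊔ b)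
... | m , n⊔b≤m , m∈X =
  m , ≤-trans (m≤m⊔n n b) n⊔b≤m , trans (agree m (≤-trans (m≤n⊔m n b) n⊔b≤m)) m∈X

-- Infinite sets are nonempty, and a set with an infinite intersection is
-- infinite: this converts between the middle-block conditions of W₁, W₂
-- and the infinite middle block the construction of (2) needs.
infinite⇒nonempty : ∀ {X : Subset} → Infinite X → NonEmpty X
infinite⇒nonempty infX = proj₁ (infX 0) , proj₂ (proj₂ (infX 0))

∩-infiniteˡ : ∀ {A B : Subset} → Infinite (A ∩ B) → Infinite A
∩-infiniteˡ {A} {B} inf n with inf n
... | m , n≤m , m∈A∩B = m , n≤m , ∩-elimˡ m m∈A∩B
  where
  ∩-elimˡ : ∀ m → m ∈ (A ∩ B) → m ∈ A
  ∩-elimˡ m m∈A∩B with A m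
  ... | true = refl
  ... | false = m∈A∩B

∩-congˡ : ∀ (A A' B : Subset) n → A n ≡ A' n → (A ∩ B) n ≡ (A' ∩ B) n
∩-congˡ A A' B n eq with A n | A' n
∩-congˡ A A' B n refl | true  | true  = refl
∩-congˡ A A' B n refl | false | false = refl

Periodic : ℕ → Subset → Set
Periodic p X = ∀ n → X (p + n) ≡ X n

periodic-infinite : ∀ p {X : Subset} → 1 ≤ p → Periodic p X → NonEmpty X → Infinite X
periodic-infinite p _ _ (r , r∈X) zero = r , z≤n , r∈X
periodic-infinite p 1≤p per ne (suc n) with periodic-infinite p 1≤p per ne n
... | m , n≤m , m∈X = p + m , ≤-trans (s≤s n≤m) (+-monoˡ-≤ m 1≤p) , trans (per m) m∈X

residue-periodic : ∀ {p} d .{{_ : NonZero d}} r → d ∣ p → Periodic p (λ n → n % d ≡ᵇ r)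
residue-periodic d r d∣p n = cong (_≡ᵇ r) (%-remove-+ˡ n d∣p)

⊑-refl : ∀ a → a ⊑ a
⊑-refl _ = (λ _ x → x) , (λ _ x → x)

⊑-trans : ∀ {a b c} → a ⊑ b → b ⊑ c → a ⊑ c
⊑-trans (ab₁ , ab₃) (bc₁ , bc₃) = (λ n x → bc₁ n (ab₁ n x)) , (λ n x → ab₃ n (bc₃ n x))

bound : ∀ {k} → Vec ℕ k → ℕ
bound []       = 0
bound (x ∷ xs) = suc x ⊔ bound xs

entry<bound : ∀ {k n} {xs : Vec ℕ k} → n ∈ᵥ xs → n < bound xs
entry<bound {xs = x ∷ xs} (here refl)  = m≤m⊔n (suc x) (bound xs)
entry<bound {xs = x ∷ xs} (there n∈xs) = <-≤-trans (entry<bound n∈xs) (m≤n⊔m (suc x) (bound xs))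

beyond-bound : ∀ {k n} {xs : Vec ℕ k} → bound xs ≤ n → n ∉ᵥ xs
beyond-bound bound≤n n∈xs = <⇒≱ (entry<bound n∈xs) bound≤n

fresh : ∀ {k} {X : Subset} (xs : Vec ℕ k) → Infinite X → ∃ λ n → n ∉ᵥ xs × n ∈ X
fresh xs infX with infX (bound xs)
... | n , bound≤n , n∈X = n , beyond-bound bound≤n , n∈X

data SnocView {k} (xs ys : Vec ℕ k) (x y : ℕ) (i : Fin (suc k)) : Set where
  old : (l : Fin k) → lookup (xs ∷ʳ x) i ≡ lookup xs l → lookup (ys ∷ʳ y) i ≡ lookup ys l →
        SnocView xs ys x y i
  new : lookup (xs ∷ʳ x) i ≡ x → lookup (ys ∷ʳ y) i ≡ y → SnocView xs ys x y i

snocView : ∀ {k} (xs ys : Vec ℕ k) x y (i : Fin (suc k)) → SnocView xs ys x y i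
snocView []       []       x y zero    = new refl refl
snocView []       []       x y (suc ())
snocView (_ ∷ xs) (_ ∷ ys) x y zero    = old zero refl refl
snocView (_ ∷ xs) (_ ∷ ys) x y (suc i) with snocView xs ys x y i
... | old l p q = old (suc l) p q
... | new p q   = new p q

Correspond : ∀ {k} → Vec ℕ k → Vec ℕ k → Set
Correspond {k} ds es = ∀ (l l' : Fin k) →
  (lookup ds l ≡ lookup ds l' → lookup es l ≡ lookup es l') ×
  (lookup es l ≡ lookup es l' → lookup ds l ≡ lookup ds l')

ZT-atom : ∀ {k a b} {ds es : Vec ℕ k} → ZT a ds b es → (p : PredSym) (l : Fin k) →
          forceT a p (lookup ds l) → forceT b p (lookup es l)
ZT-atom (_ , keep₁ , keep₂) P l (inj₁ d∈A) = inj₁ (keep₁ l d∈A)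
ZT-atom (_ , keep₁ , keep₂) P l (inj₂ d∈B) = keep₂ l d∈B
ZT-atom (_ , keep₁ , keep₂) Q l d∈A        = keep₁ l d∈A

ZT-snoc : ∀ {k a b} {ds es : Vec ℕ k} {f g} → ZT a ds b es →
          (∀ l → (lookup ds l ≡ f → lookup es l ≡ g) × (lookup es l ≡ g → lookup ds l ≡ f)) →
          (f ∈ p₁ a → g ∈ p₁ b) → (f ∈ p₂ a → g ∈ p₁ b ⊎ g ∈ p₂ b) →
          ZT a (ds ∷ʳ f) b (es ∷ʳ g)
ZT-snoc {a = a} {b} {ds} {es} {f} {g} (corr , keep₁ , keep₂) same new₁ new₂ = corr' , keep₁' , keep₂'
  where
  corr' : Correspond (ds ∷ʳ f) (es ∷ʳ g)
  corr' i j with snocView ds es f g i | snocView ds es f g j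
  ... | old l p q | old l' p' q' rewrite p | q | p' | q' = corr l l'
  ... | old l p q | new p' q'    rewrite p | q | p' | q' = same l
  ... | new p q   | old l' p' q' rewrite p | q | p' | q' =
    (λ e → sym (proj₁ (same l') (sym e))) , (λ e → sym (proj₂ (same l') (sym e)))
  ... | new p q   | new p' q'    rewrite p | q | p' | q' = (λ _ → refl) , (λ _ → refl)
  keep₁' : ∀ i → lookup (ds ∷ʳ f) i ∈ p₁ a → lookup (es ∷ʳ g) i ∈ p₁ b
  keep₁' i with snocView ds es f g i
  ... | old l p q rewrite p | q = keep₁ l
  ... | new p q   rewrite p | q = new₁
  keep₂' : ∀ i → lookup (ds ∷ʳ f) i ∈ p₂ a → lookup (es ∷ʳ g) i ∈ p₁ b ⊎ lookup (es ∷ʳ g) i ∈ p₂ b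
  keep₂' i with snocView ds es f g i
  ... | old l p q rewrite p | q = keep₂ l
  ... | new p q   rewrite p | q = new₂

ZT-snoc-old : ∀ {k a b} {ds es : Vec ℕ k} {f g} → ZT a ds b es → (l : Fin k) →
              f ≡ lookup ds l → g ≡ lookup es l → ZT a (ds ∷ʳ f) b (es ∷ʳ g)
ZT-snoc-old {a = a} {b} {ds} {es} z@(corr , keep₁ , keep₂) l refl refl =
  ZT-snoc {a = a} {b} {ds} {es} z (λ l' → corr l' l) (keep₁ l) (keep₂ l)

ZT-snoc-fresh : ∀ {k a b} {ds es : Vec ℕ k} {f g} → ZT a ds b es → f ∉ᵥ ds → g ∉ᵥ es →
                (f ∈ p₁ a → g ∈ p₁ b) → (f ∈ p₂ a → g ∈ p₁ b ⊎ g ∈ p₂ b) →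
                ZT a (ds ∷ʳ f) b (es ∷ʳ g)
ZT-snoc-fresh {a = a} {b} {ds} {es} z f∉ds g∉es = ZT-snoc {a = a} {b} {ds} {es} z λ l →
  (λ e → ⊥-elim (f∉ds (subst (_∈ᵥ ds) e (∈-lookup l ds)))) ,
  (λ e → ⊥-elim (g∉es (subst (_∈ᵥ es) e (∈-lookup l es))))

ZT-forth : ∀ {k a b} {ds es : Vec ℕ k} → Infinite (p₁ b) → ZT a ds b es → (f : ℕ) →
           Σ ℕ λ g → ZT a (ds ∷ʳ f) b (es ∷ʳ g)
ZT-forth {a = a} {b} {ds} {es} infA z f with f ∈? ds
... | yes f∈ds = lookup es (index f∈ds) ,
                 ZT-snoc-old {a = a} {b} {ds} {es} z (index f∈ds) (lookup-index f∈ds) refl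
... | no f∉ds with fresh es infA
...   | g , g∉es , g∈A =
  g , ZT-snoc-fresh {a = a} {b} {ds} {es} z f∉ds g∉es (λ _ → g∈A) (λ _ → inj₁ g∈A)

ZT-forth' : ∀ {k a b} {ds es : Vec ℕ k} → IsQuasiPartition a → ZT a ds b es → (g : ℕ) →
            Σ ℕ λ f → ZT a (ds ∷ʳ f) b (es ∷ʳ g)
ZT-forth' {a = a} {b} {ds} {es} qa z g with g ∈? es
... | yes g∈es = lookup ds (index g∈es) ,
                 ZT-snoc-old {a = a} {b} {ds} {es} z (index g∈es) refl (lookup-index g∈es)
... | no g∉es with fresh ds (inf₃ qa)
...   | f , f∉ds , f∈C = f , ZT-snoc-fresh {a = a} {b} {ds} {es} z f∉ds g∉es
          (λ f∈A → ⊥-elim (disj₁₃ qa f f∈A f∈C)) (λ f∈B → ⊥-elim (disj₂₃ qa f f∈B f∈C))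

ZT-reflects₃ : ∀ {k a b} (ds es : Vec ℕ k) → IsQuasiPartition a → IsQuasiPartition b →
               ZT a ds b es → ∀ l → lookup es l ∈ p₃ b → lookup ds l ∈ p₃ a
ZT-reflects₃ ds es qa qb (_ , keep₁ , keep₂) l e∈C with cover qa (lookup ds l)
... | inj₁ d∈A          = ⊥-elim (disj₁₃ qb _ (keep₁ l d∈A) e∈C)
... | inj₂ (inj₂ d∈C)   = d∈C
... | inj₂ (inj₁ d∈B) with keep₂ l d∈B
...   | inj₁ e∈A = ⊥-elim (disj₁₃ qb _ e∈A e∈C)
...   | inj₂ e∈B = ⊥-elim (disj₂₃ qb _ e∈B e∈C)

copyOn : ∀ {k} → Vec ℕ k → Vec ℕ k → Subset → Subset → Subset
copyOn ks vs X Y n with n ∈? ks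
... | yes n∈ks = Y (lookup vs (index n∈ks))
... | no _     = X n

copy : ∀ {k} → Vec ℕ k → Vec ℕ k → Triple → Triple → Triple
copy ks vs d c =
  ⟨ copyOn ks vs (p₁ d) (p₁ c) , copyOn ks vs (p₂ d) (p₂ c) , copyOn ks vs (p₃ d) (p₃ c) ⟩

copyOn-entry : ∀ {k} {X Y : Subset} {ks vs : Vec ℕ k} → Correspond ks vs → ∀ l →
               copyOn ks vs X Y (lookup ks l) ≡ Y (lookup vs l)
copyOn-entry {Y = Y} {ks} corr l with lookup ks l ∈? ks
... | yes k∈ks = cong Y (proj₁ (corr (index k∈ks) l) (sym (lookup-index k∈ks)))
... | no k∉ks  = ⊥-elim (k∉ks (∈-lookup l ks))

copyOn-beyond : ∀ {k} (ks vs : Vec ℕ k) (X Y : Subset) {n} → bound ks ≤ n →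
                copyOn ks vs X Y n ≡ X n
copyOn-beyond ks vs X Y {n} bound≤n with n ∈? ks
... | yes n∈ks = ⊥-elim (beyond-bound bound≤n n∈ks)
... | no _     = refl

copyOn-infinite : ∀ {k} (ks vs : Vec ℕ k) (X Y : Subset) → Infinite X → Infinite (copyOn ks vs X Y)
copyOn-infinite ks vs X Y = infinite-cofinite (bound ks) (λ _ → copyOn-beyond ks vs X Y)

copy-pointwise : ∀ {k} (ks vs : Vec ℕ k) (d c : Triple) (R : Bool → Bool → Bool → Set) →
                 (∀ n → R (p₁ d n) (p₂ d n) (p₃ d n)) → (∀ n → R (p₁ c n) (p₂ c n) (p₃ c n)) →
                 let m = copy ks vs d c in ∀ n → R (p₁ m n) (p₂ m n) (p₃ m n)
copy-pointwise ks vs d c R Rd Rc n with n ∈? ks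
... | yes n∈ks = Rc (lookup vs (index n∈ks))
... | no _     = Rd n

copy-QP : ∀ {k} (ks vs : Vec ℕ k) {d c : Triple} → IsQuasiPartition d → Infinite (p₂ d) →
          IsQuasiPartition c → IsQuasiPartition (copy ks vs d c)
copy-QP ks vs {d} {c} qd midD qc = record
  { disj₁₂ = copy-pointwise ks vs d c (λ x y _ → x ≡ true → ¬ y ≡ true) (disj₁₂ qd) (disj₁₂ qc)
  ; disj₁₃ = copy-pointwise ks vs d c (λ x _ z → x ≡ true → ¬ z ≡ true) (disj₁₃ qd) (disj₁₃ qc)
  ; disj₂₃ = copy-pointwise ks vs d c (λ _ y z → y ≡ true → ¬ z ≡ true) (disj₂₃ qd) (disj₂₃ qc)
  ; cover  = copy-pointwise ks vs d c (λ x y z → x ≡ true ⊎ (y ≡ true ⊎ z ≡ true)) (cover qd) (cover qc)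
  ; inf₁   = copyOn-infinite ks vs (p₁ d) (p₁ c) (inf₁ qd)
  ; inf₃   = copyOn-infinite ks vs (p₃ d) (p₃ c) (inf₃ qd)
  ; mid    = inj₂ (copyOn-infinite ks vs (p₂ d) (p₂ c) midD)
  }

copy-extends : ∀ {k} (ks vs : Vec ℕ k) (d c : Triple) {a b : Triple} → IsQuasiPartition a →
               IsQuasiPartition b → ZT a ks b vs → b ⊑ c → a ⊑ d → a ⊑ copy ks vs d c
copy-extends ks vs d c {a} {b} qa qb z@(_ , keep₁ , _) (b⊑c₁ , b⊑c₃) (a⊑d₁ , a⊑d₃) =
  first , third
  where
  first : ∀ n → n ∈ p₁ a → n ∈ copyOn ks vs (p₁ d) (p₁ c)
  first n n∈A with n ∈? ks
  ... | yes n∈ks = b⊑c₁ _ (keep₁ (index n∈ks) (subst (_∈ p₁ a) (lookup-index n∈ks) n∈A))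
  ... | no _     = a⊑d₁ n n∈A
  third : ∀ n → n ∈ copyOn ks vs (p₃ d) (p₃ c) → n ∈ p₃ a
  third n n∈C with n ∈? ks
  ... | yes n∈ks = subst (_∈ p₃ a) (sym (lookup-index n∈ks))
                         (ZT-reflects₃ ks vs qa qb z (index n∈ks) (b⊑c₃ _ n∈C))
  ... | no _     = a⊑d₃ n n∈C

BackTo : ∀ {k} → Triple → Vec ℕ k → Triple → Vec ℕ k → Triple → Set
BackTo a ds c es m = a ⊑ m × ZT m ds c es × ZT c es m ds

copy-back : ∀ {k} (ks vs : Vec ℕ k) (d c : Triple) {a b : Triple} → IsQuasiPartition a →
            IsQuasiPartition b → ZT a ks b vs → b ⊑ c → a ⊑ d → BackTo a ks c vs (copy ks vs d c)
copy-back ks vs d c qa qb z@(corr , _ , _) b⊑c a⊑d =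
  copy-extends ks vs d c qa qb z b⊑c a⊑d ,
  (corr , (λ l k∈A → trans (sym (entry₁ l)) k∈A)
        , (λ l k∈B → inj₂ (trans (sym (entry₂ l)) k∈B))) ,
  ((λ l l' → swap (corr l l')) , (λ l v∈A → trans (entry₁ l) v∈A)
                               , (λ l v∈B → inj₂ (trans (entry₂ l) v∈B)))
  where
  entry₁ : ∀ l → copyOn ks vs (p₁ d) (p₁ c) (lookup ks l) ≡ p₁ c (lookup vs l)
  entry₁ = copyOn-entry {X = p₁ d} {p₁ c} {ks} {vs} corr
  entry₂ : ∀ l → copyOn ks vs (p₂ d) (p₂ c) (lookup ks l) ≡ p₂ c (lookup vs l)
  entry₂ = copyOn-entry {X = p₂ d} {p₂ c} {ks} {vs} corr

record Enlargement (u : Triple) : Set where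
  field
    triple          : Triple
    isQP            : IsQuasiPartition triple
    middle-infinite : Infinite (p₂ triple)
    enlarges        : u ⊑ triple

self-enlargement : ∀ {u} → IsQuasiPartition u → NonEmpty (p₂ u) → Enlargement u
self-enlargement {u} qu (n , n∈B) = record
  { triple = u ; isQP = qu ; middle-infinite = middle ; enlarges = ⊑-refl u }
  where
  middle : Infinite (p₂ u)
  middle with mid qu
  ... | inj₁ empty = ⊥-elim (empty n n∈B)
  ... | inj₂ inf   = inf

parity : ∀ n → n ∈ p₁ 𝐰 ⊎ n ∈ p₃ 𝐰
parity n with n % 2 | m%n<n n 2
... | 0           | _ = inj₁ refl
... | 1           | _ = inj₂ refl
... | suc (suc _) | s≤s (s≤s ())


even-not-odd : ∀ n → n ∈ p₁ 𝐰 → ¬ n ∈ p₃ 𝐰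
even-not-odd n with n % 2
... | zero  = λ _ ()
... | suc _ = λ ()

qp𝐰 : IsQuasiPartition 𝐰
qp𝐰 = record
  { disj₁₂ = λ _ _ ()
  ; disj₁₃ = even-not-odd
  ; disj₂₃ = λ _ ()
  ; cover  = λ n → [ inj₁ , (λ odd → inj₂ (inj₂ odd)) ]′ (parity n)
  ; inf₁   = periodic-infinite 2 (s≤s z≤n) (residue-periodic 2 0 ∣-refl) (0 , refl)
  ; inf₃   = periodic-infinite 2 (s≤s z≤n) (residue-periodic 2 1 ∣-refl) (1 , refl)
  ; mid    = inj₁ (λ _ ())
  }

∧-elimˡ : ∀ x {y} → x ∧ y ≡ true → x ≡ true
∧-elimˡ true  _  = refl
∧-elimˡ false ()

∧-split : ∀ x y → x ≡ true → x ∧ y ≡ true ⊎ x ∧ not y ≡ true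
∧-split true true  _ = inj₁ refl
∧-split true false _ = inj₂ refl

∧-complement : ∀ x y → x ∧ y ≡ true → ¬ x ∧ not y ≡ true
∧-complement true true  _ ()
∧-complement true false ()

oneMod4 : Subset
oneMod4 n = n % 4 ≡ᵇ 1

𝐰' : Triple
𝐰' = ⟨ p₁ 𝐰 , (λ n → p₃ 𝐰 n ∧ oneMod4 n) , (λ n → p₃ 𝐰 n ∧ not (oneMod4 n)) ⟩

𝐰'-periodic : ∀ (S : Bool → Bool) → Periodic 4 (λ n → p₃ 𝐰 n ∧ S (oneMod4 n))
𝐰'-periodic S n =
  cong₂ _∧_ (residue-periodic 2 1 (divides 2 refl) n) (cong S (residue-periodic 4 1 ∣-refl n))

𝐰-enlargement : Enlargement 𝐰
𝐰-enlargement = record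
  { triple          = 𝐰'
  ; isQP            = qp𝐰'
  ; middle-infinite = middle
  ; enlarges        = (λ _ n∈A → n∈A) , (λ n → ∧-elimˡ (p₃ 𝐰 n))
  }
  where
  middle : Infinite (p₂ 𝐰')
  middle = periodic-infinite 4 (s≤s z≤n) (𝐰'-periodic (λ x → x)) (1 , refl)
  qp𝐰' : IsQuasiPartition 𝐰'
  qp𝐰' = record
    { disj₁₂ = λ n n∈A n∈B → even-not-odd n n∈A (∧-elimˡ (p₃ 𝐰 n) n∈B)
    ; disj₁₃ = λ n n∈A n∈C → even-not-odd n n∈A (∧-elimˡ (p₃ 𝐰 n) n∈C)
    ; disj₂₃ = λ n → ∧-complement (p₃ 𝐰 n) (oneMod4 n)
    ; cover  = λ n → [ inj₁ , (λ odd → inj₂ (∧-split (p₃ 𝐰 n) (oneMod4 n) odd)) ]′ (parity n)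
    ; inf₁   = inf₁ qp𝐰
    ; inf₃   = periodic-infinite 4 (s≤s z≤n) (𝐰'-periodic not) (3 , refl)
    ; mid    = inj₂ middle
    }

TripleModel : (X : Set) → (X → Triple) → GModel
TripleModel X tri = record
  { W = X ; _≼_ = λ s t → tri s ⊑ tri t ; D = ℕ ; force = λ s → forceT (tri s) }

ZOn : ∀ {X Y : Set} (triX : X → Triple) (triY : Y → Triple) →
      ZRel (TripleModel X triX) (TripleModel Y triY)
ZOn triX triY s ds t es = ZT (triX s) ds (triY t) es

BackCondition : ∀ {X Y : Set} → (X → Triple) → (Y → Triple) → Set
BackCondition {X} {Y} triX triY = ∀ {k} (t : X) (ds : Vec ℕ k) (u : Y) (es : Vec ℕ k) →
  ZT (triX t) ds (triY u) es → (v : Y) → triY u ⊑ triY v →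
  Σ X λ w → BackTo (triX t) ds (triY v) es (triX w)

asimHalf : ∀ {X Y : Set} (triX : X → Triple) (triY : Y → Triple) →
           (∀ s → IsQuasiPartition (triX s)) → (∀ t → IsQuasiPartition (triY t)) →
           BackCondition triX triY →
           AsimHalf (TripleModel X triX) (TripleModel Y triY) (ZOn triX triY) (ZOn triY triX)
asimHalf triX triY qpX qpY back = record
  { atom   = λ {_} {t} {ds} {u} {es} z → ZT-atom {a = triX t} {triY u} {ds} {es} z
  ; back   = λ {_} {t} {ds} {u} {es} → back t ds u es
  ; forth  = λ {_} {t} {ds} {u} {es} z → ZT-forth {a = triX t} {triY u} {ds} {es} (inf₁ (qpY u)) z
  ; forth' = λ {_} {t} {ds} {u} {es} z → ZT-forth' {a = triX t} {triY u} {ds} {es} (qpX t) z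
  }

qp₁ : (s : W₁) → IsQuasiPartition (tri₁ s)
qp₁ s = proj₁ (proj₂ s)

qp₂ : (s : W₂) → IsQuasiPartition (tri₂ s)
qp₂ base₂         = qp𝐰
qp₂ (st₂ _ qu _ _) = qu

𝐰⊑tri₂ : (s : W₂) → 𝐰 ⊑ tri₂ s
𝐰⊑tri₂ base₂          = ⊑-refl 𝐰
𝐰⊑tri₂ (st₂ _ _ 𝐰⊑u _) = 𝐰⊑u

enlargement₂ : (s : W₂) → Enlargement (tri₂ s)
enlargement₂ base₂            = 𝐰-enlargement
enlargement₂ (st₂ _ qu _ neB) = self-enlargement qu neB

-- Condition (2) from M₁ to M₂: a state of M₁ is its own enlargement, and
-- the copy keeps the infinite part of the middle block inside 3ℕ+1.
back₁₂ : BackCondition tri₁ tri₂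
back₁₂ (a , qa , 𝐯⊑a , midA∩) ds u es z v u⊑v =
  (m , copy-QP ds es qa (∩-infiniteˡ midA∩) (qp₂ v) , ⊑-trans {𝐯} {a} {m} 𝐯⊑a (proj₁ step) , midM∩) ,
  step
  where
  m : Triple
  m = copy ds es a (tri₂ v)
  step : BackTo a ds (tri₂ v) es m
  step = copy-back ds es a (tri₂ v) qa (qp₂ u) z u⊑v (⊑-refl a)
  midM∩ : Infinite (p₂ m ∩ p₂ 𝐯)
  midM∩ = infinite-cofinite (bound ds)
    (λ n bound≤n → ∩-congˡ (p₂ m) (p₂ a) (p₂ 𝐯) n (copyOn-beyond ds es (p₂ a) (p₂ (tri₂ v)) bound≤n))
    midA∩

back₂₁ : BackCondition tri₂ tri₁
back₂₁ t ds u es z v u⊑v =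
  st₂ m (copy-QP ds es isQP middle-infinite (qp₁ v))
        (⊑-trans {𝐰} {tri₂ t} {m} (𝐰⊑tri₂ t) (proj₁ step))
        (infinite⇒nonempty (copyOn-infinite ds es (p₂ triple) (p₂ (tri₁ v)) middle-infinite)) ,
  step
  where
  open Enlargement (enlargement₂ t)
  m : Triple
  m = copy ds es triple (tri₁ v)
  step : BackTo (tri₂ t) ds (tri₁ v) es m
  step = copy-back ds es triple (tri₁ v) (qp₂ t) (qp₁ u) z u⊑v enlarges

lemma5p2 : IsCDAsimulation M₁ M₂ Z₁₂ Z₂₁
lemma5p2 = asimHalf tri₁ tri₂ qp₁ qp₂ back₁₂ , asimHalf tri₂ tri₁ qp₂ qp₁ back₂₁
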